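{- Let $m\ge 2$ be an integer with $\omega(m)=1$. Then $m=n$, $m=2n$ or $m=4n$ for some odd positive integer $n$ all of whose positive divisors $d$ satisfy $\omega(d)=1$.
   Context: $F_n$ denotes the Fibonacci sequence: $F_0=0$, $F_1=1$, $F_n=F_{n-1}+F_{n-2}$. For an integer $m\ge 2$, the Pisano period $\pi(m)$ is the least positive period of $(F_n \bmod m)$, and $\omega(m)$ is the number of indices $0\le n<\pi(m)$ with $m\mid F_n$. By convention $\omega(1)=1$. -}

module Defs where

open import Data.Nat using (ℕ; zero; suc; _+_; _<_; _≤_; NonZero)
open import Data.Nat.DivMod using (_%_)
open import Data.Nat.Divisibility using (_∣_; _∣?_)
open import Data.List using (List; filter; length; upTo)
open import Data.Product using (Σ; _×_; ∃)
open import Data.Empty using (⊥)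
open import Relation.Binary.PropositionalEquality using (_≡_)

F : ℕ → ℕ
F zero = 0
F (suc zero) = 1
F (suc (suc n)) = F (suc n) + F n

IsPeriod : (m : ℕ) .{{_ : NonZero m}} → ℕ → Set
IsPeriod m p = ∀ n → F (n + p) % m ≡ F n % m

IsPisanoPeriod : (m : ℕ) .{{_ : NonZero m}} → ℕ → Set
IsPisanoPeriod m p = (0 < p) × IsPeriod m p × (∀ q → 0 < q → IsPeriod m q → p ≤ q)

zeroCount : ℕ → ℕ → ℕ
zeroCount m p = length (filter (λ n → m ∣? F n) (upTo p))

-- OmegaIs m k  :  "ω(m) = k"  (for m ≥ 1; convention ω(1) = 1; m = 0 is outside the domain)
OmegaIs : ℕ → ℕ → Set
OmegaIs zero k = ⊥
OmegaIs (suc zero) k = k ≡ 1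
OmegaIs (suc (suc j)) k =
  ∃ λ p → IsPisanoPeriod (suc (suc j)) p × zeroCount (suc (suc j)) p ≡ k

{-# OPTIONS --safe #-}
-- Let α be the entry point of d (the least α > 0 with d ∣ F α) and c = F (α + 1).
-- The addition formula gives F (n + k α) ≡ c ^ k · F n (mod d), so ω(d) = 1 exactly
-- when c ≡ 1 (mod d), and Cassini's identity gives c² ≡ (-1)^α (mod d).
-- If ω(m) = 1 with m ≥ 3, the Pisano period p of m is its entry point and p ≡ 2 (mod 4):
-- an odd p would give 1 ≡ c² ≡ -1, and p = 2N with N even would give m ∣ F N, because
-- F (2N) = L N · F N, F (2N + 1) = 1 + L (N + 1) · F N and consecutive Lucas numbers
-- are coprime.  For a divisor d ≥ 3 of m with multiplier c we have p = k α and c ^ k ≡ 1;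
-- since p ≡ 2 (mod 4), either α is even and k odd, so c ≡ c ^ k ≡ 1, or α is odd and
-- k ≡ 2 (mod 4), so -1 ≡ c² ≡ c ^ k ≡ 1, which is impossible.  Hence every divisor
-- d ≥ 3 of m has ω(d) = 1.  Since ω(8) ≠ 1, 8 ∤ m, and the odd part of m is the n sought.
module Submission where

open import Defs
open import Data.List using ([]; _∷_; filter; length; applyUpTo)
open import Data.List.Properties using (filter-accept; filter-none; filter-some)
import Data.List.Relation.Unary.All.Properties as All
import Data.List.Relation.Unary.Any.Properties as Any
open import Data.Nat
  using (ℕ; zero; suc; _+_; _∸_; _*_; _^_; _≤_; _<_; NonZero; >-nonZero; z<s; s<s; z≤n; s≤s)
open import Data.Nat.Coprimality using (Coprime; coprime-+; coprime-divisor; coprime-factors)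
import Data.Nat.Coprimality as Coprimality
open import Data.Nat.Divisibility
  using (_∣_; _∣?_; divides; _∣0; ∣-refl; ∣-trans; ∣⇒≤; ∣1⇒≡1; n∣m*n; m%n≡0⇒n∣m; n∣m⇒m%n≡0)
open import Data.Nat.DivMod
  using (_%_; _/_; %-distribˡ-+; %-distribˡ-*; m≡m%n+[m/n]*n; m%n<n; m%n≤n; m∣n⇒o%n%m≡o%m)
open import Data.Nat.Induction using (<-rec)
open import Data.Nat.Properties
open import Algebra.Properties.CommutativeSemigroup +-commutativeSemigroup
  using (interchange) renaming (x∙yz≈y∙xz to x+[y+z]≡y+[x+z])
open import Algebra.Properties.CommutativeSemigroup *-commutativeSemigroup
  using () renaming (x∙yz≈y∙xz to x*[y*z]≡y*[x*z])
open import Data.Nat.Tactic.RingSolver using (solve-∀; solve)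
open import Data.Product using (∃; ∃-syntax; _,_; _×_)
open import Data.Sum using (_⊎_; inj₁; inj₂)
open import Data.Empty using (⊥-elim)
open import Function using (_∘_)
open import Level using (0ℓ)
open import Relation.Binary.Bundles using (Setoid)
open import Relation.Binary.Structures using (IsEquivalence)
import Relation.Binary.Reasoning.Setoid as SetoidReasoning
open import Relation.Binary.PropositionalEquality
open import Relation.Nullary using (¬_; ¬?; yes; no; contradiction)
open import Relation.Nullary.Decidable using (from-yes)
open import Relation.Unary using (Pred; Decidable)

F-add : ∀ m n → F (suc (m + n)) ≡ F (suc m) * F (suc n) + F m * F n
F-add zero n = identity (F (suc n)) (F n)
  where identity : ∀ x y → x ≡ 1 * x + 0 * y
        identity = solve-∀
F-add (suc zero) n = identity (F (suc n)) (F n)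
  where identity : ∀ x y → x + y ≡ 1 * x + 1 * y
        identity = solve-∀
F-add (suc (suc m)) n = begin
  F (suc (suc m + n)) + F (suc (m + n))
    ≡⟨ cong₂ _+_ (F-add (suc m) n) (F-add m n) ⟩
  (F (2 + m) * F (suc n) + F (1 + m) * F n) + (F (1 + m) * F (suc n) + F m * F n)
    ≡⟨ regroup (F (1 + m)) (F m) (F (suc n)) (F n) ⟩
  F (3 + m) * F (suc n) + F (2 + m) * F n ∎
  where open ≡-Reasoning
        regroup : ∀ a b x y → ((a + b) * x + a * y) + (a * x + b * y) ≡ ((a + b) + a) * x + (a + b) * y
        regroup = solve-∀

cassini-step⁺ : ∀ x y → y * (x + y) + 1 ≡ x * x → x * ((x + y) + x) ≡ (x + y) * (x + y) + 1
cassini-step⁺ x y cassini = begin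
  x * ((x + y) + x)               ≡⟨ solve (x ∷ y ∷ []) ⟩
  x * (x + y) + x * x             ≡⟨ cong (x * (x + y) +_) (sym cassini) ⟩
  x * (x + y) + (y * (x + y) + 1) ≡⟨ solve (x ∷ y ∷ []) ⟩
  (x + y) * (x + y) + 1           ∎
  where open ≡-Reasoning

cassini-step⁻ : ∀ x y → y * (x + y) ≡ x * x + 1 → x * ((x + y) + x) + 1 ≡ (x + y) * (x + y)
cassini-step⁻ x y cassini = begin
  x * ((x + y) + x) + 1       ≡⟨ solve (x ∷ y ∷ []) ⟩
  x * (x + y) + (x * x + 1)   ≡⟨ cong (x * (x + y) +_) (sym cassini) ⟩
  x * (x + y) + y * (x + y)   ≡⟨ solve (x ∷ y ∷ []) ⟩
  (x + y) * (x + y)           ∎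
  where open ≡-Reasoning

cassini-even : ∀ k → F (2 * k) * F (2 + 2 * k) + 1 ≡ F (1 + 2 * k) * F (1 + 2 * k)
cassini-odd  : ∀ k → F (1 + 2 * k) * F (3 + 2 * k) ≡ F (2 + 2 * k) * F (2 + 2 * k) + 1

cassini-even zero    = refl
cassini-even (suc k) =
  subst (λ n → F n * F (2 + n) + 1 ≡ F (1 + n) * F (1 + n)) (sym (*-suc 2 k))
        (cassini-step⁻ (F (2 + 2 * k)) (F (1 + 2 * k)) (cassini-odd k))
cassini-odd k = cassini-step⁺ (F (1 + 2 * k)) (F (2 * k)) (cassini-even k)

L : ℕ → ℕ
L zero             = 2
L (suc zero)       = 1
L (suc (suc n))    = L (suc n) + L n

L-suc : ∀ n → L (suc n) ≡ F n + F (2 + n)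
L-suc zero          = refl
L-suc (suc zero)    = refl
L-suc (suc (suc n)) = begin
  L (2 + n) + L (1 + n)                         ≡⟨ cong₂ _+_ (L-suc (suc n)) (L-suc n) ⟩
  (F (1 + n) + F (3 + n)) + (F n + F (2 + n))   ≡⟨ interchange (F (1 + n)) (F (3 + n)) (F n) (F (2 + n)) ⟩
  F (2 + n) + F (4 + n)                         ∎
  where open ≡-Reasoning

2*n≡n+n : ∀ n → 2 * n ≡ n + n
2*n≡n+n n = cong (n +_) (+-identityʳ n)

F-double : ∀ n → F (2 * n) ≡ L n * F n
F-double zero    = refl
F-double (suc n) = begin
  F (2 * suc n)                             ≡⟨ cong F (2*n≡n+n (suc n)) ⟩
  F (suc (n + suc n))                       ≡⟨ F-add n (suc n) ⟩
  F (1 + n) * F (2 + n) + F n * F (1 + n)   ≡⟨ factor (F (1 + n)) (F (2 + n)) (F n) ⟩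
  (F n + F (2 + n)) * F (1 + n)             ≡⟨ cong (_* F (1 + n)) (L-suc n) ⟨
  L (suc n) * F (suc n)                     ∎
  where open ≡-Reasoning
        factor : ∀ x y z → x * y + z * x ≡ (z + y) * x
        factor = solve-∀

F-double-suc-even : ∀ k → F (1 + 2 * (2 * k)) ≡ 1 + L (1 + 2 * k) * F (2 * k)
F-double-suc-even k = begin
  F (1 + 2 * N)                     ≡⟨ cong (F ∘ suc) (2*n≡n+n N) ⟩
  F (suc (N + N))                   ≡⟨ F-add N N ⟩
  F (1 + N) * F (1 + N) + F N * F N ≡⟨ cong (_+ F N * F N) (cassini-even k) ⟨
  (F N * F (2 + N) + 1) + F N * F N ≡⟨ regroup (F N) (F (2 + N)) ⟩
  1 + (F N + F (2 + N)) * F N       ≡⟨ cong (λ l → 1 + l * F N) (L-suc N) ⟨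
  1 + L (1 + N) * F N               ∎
  where open ≡-Reasoning
        N : ℕ
        N = 2 * k
        regroup : ∀ x y → (x * y + 1) + x * x ≡ 1 + (x + y) * x
        regroup = solve-∀

F-coprime : ∀ n → Coprime (F n) (F (suc n))
F-coprime zero    (_ , i∣1) = ∣1⇒≡1 i∣1
F-coprime (suc n) = Coprimality.sym (coprime-+ (F-coprime n))

L-coprime : ∀ n → Coprime (L n) (L (suc n))
L-coprime zero    (_ , i∣1) = ∣1⇒≡1 i∣1
L-coprime (suc n) = Coprimality.sym (coprime-+ (L-coprime n))

Odd : ℕ → Set
Odd n = ∃[ k ] n ≡ 1 + 2 * k

data EvenOrOdd : ℕ → Set where
  even : ∀ k → EvenOrOdd (2 * k)
  odd  : ∀ k → EvenOrOdd (1 + 2 * k)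

evenOrOdd : ∀ n → EvenOrOdd n
evenOrOdd zero = even 0
evenOrOdd (suc n) with evenOrOdd n
... | even k = odd k
... | odd k  = subst EvenOrOdd (*-suc 2 k) (even (suc k))

*-odd⇒oddˡ : ∀ m n {t} → m * n ≡ 1 + 2 * t → Odd m
*-odd⇒oddˡ m n {t} mn≡1+2t with evenOrOdd m
... | odd k  = k , refl
... | even k = ⊥-elim (even≢odd (k * n) t (trans (sym (*-assoc 2 k n)) mn≡1+2t))

factors-of-twice-odd : ∀ k α {q} → k * α ≡ 2 * q → Odd q →
                       (∃[ a ] α ≡ 2 * a × Odd k) ⊎ (Odd α × ∃[ j ] k ≡ 2 * j × Odd j)
factors-of-twice-odd k α {q} kα≡2q (t , q≡1+2t) with evenOrOdd α | evenOrOdd k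
... | even a | _ = inj₁ (a , refl , *-odd⇒oddˡ k a {t} (trans ka≡q q≡1+2t))
  where ka≡q : k * a ≡ q
        ka≡q = *-cancelˡ-≡ (k * a) q 2 (trans (sym (x*[y*z]≡y*[x*z] k 2 a)) kα≡2q)
... | odd a | odd j = ⊥-elim (even≢odd q (j + a * (1 + 2 * j)) (trans (sym kα≡2q) (odd·odd j a)))
  where odd·odd : ∀ j a → (1 + 2 * j) * (1 + 2 * a) ≡ 1 + 2 * (j + a * (1 + 2 * j))
        odd·odd = solve-∀
... | odd a | even j = inj₂ ((a , refl) , j , refl , *-odd⇒oddˡ j α {t} (trans jα≡q q≡1+2t))
  where jα≡q : j * α ≡ q
        jα≡q = *-cancelˡ-≡ (j * α) q 2 (trans (sym (*-assoc 2 j α)) kα≡2q)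

odd⇒2∤ : ∀ {n} → Odd n → ¬ 2 ∣ n
odd⇒2∤ (k , refl) (divides q 1+2k≡q*2) = even≢odd q k (trans (*-comm 2 q) (sym 1+2k≡q*2))

m≥3⇒m∤2 : ∀ {m} → 3 ≤ m → ¬ m ∣ 2
m≥3⇒m∤2 3≤m m∣2 = contradiction (≤-trans 3≤m (∣⇒≤ m∣2)) λ { (s≤s (s≤s ())) }

two-adic-split : ∀ m → ¬ 8 ∣ m → ∃[ n ] Odd n × (m ≡ n ⊎ m ≡ 2 * n ⊎ m ≡ 4 * n)
two-adic-split m 8∤m with evenOrOdd m
... | odd k = _ , (k , refl) , inj₁ refl
... | even m₁ with evenOrOdd m₁
...   | odd k = _ , (k , refl) , inj₂ (inj₁ refl)
...   | even m₂ with evenOrOdd m₂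
...     | odd k  = _ , (k , refl) , inj₂ (inj₂ (sym (*-assoc 2 2 (1 + 2 * k))))
...     | even k = contradiction (divides k (eight k)) 8∤m
  where eight : ∀ k → 2 * (2 * (2 * k)) ≡ k * 8
        eight = solve-∀

-- A record rather than a synonym for  x % d ≡ y % d , so that x and y are inferable.
infix 4 _≡_[mod_]
record _≡_[mod_] (x y d : ℕ) .{{_ : NonZero d}} : Set where
  constructor mod-≡
  field %-≡ : x % d ≡ y % d

≡-mod-divisor : ∀ {x y d m} .{{_ : NonZero d}} .{{_ : NonZero m}} → d ∣ m →
                x ≡ y [mod m ] → x ≡ y [mod d ]
≡-mod-divisor {x} {y} {d} {m} d∣m (mod-≡ x≡y) = mod-≡ (begin
  x % d       ≡⟨ m∣n⇒o%n%m≡o%m d m x d∣m ⟨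
  x % m % d   ≡⟨ cong (_% d) x≡y ⟩
  y % m % d   ≡⟨ m∣n⇒o%n%m≡o%m d m y d∣m ⟩
  y % d       ∎)
  where open ≡-Reasoning

module Modulo (d : ℕ) .{{_ : NonZero d}} where

  infix 4 _≈_
  _≈_ : ℕ → ℕ → Set
  x ≈ y = x ≡ y [mod d ]

  ≈-isEquivalence : IsEquivalence _≈_
  ≈-isEquivalence = record
    { refl  = mod-≡ refl
    ; sym   = λ (mod-≡ x≡y) → mod-≡ (sym x≡y)
    ; trans = λ (mod-≡ x≡y) (mod-≡ y≡z) → mod-≡ (trans x≡y y≡z)
    }

  ≈-setoid : Setoid 0ℓ 0ℓ
  ≈-setoid = record { isEquivalence = ≈-isEquivalence }

  open IsEquivalence ≈-isEquivalence public
    using () renaming (refl to ≈-refl; sym to ≈-sym; trans to ≈-trans; reflexive to ≈-reflexive)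
  module ≈-Reasoning = SetoidReasoning ≈-setoid

  +-cong : ∀ {a b x y} → a ≈ b → x ≈ y → a + x ≈ b + y
  +-cong {a} {b} {x} {y} (mod-≡ a≡b) (mod-≡ x≡y) = mod-≡ (begin
    (a + x) % d             ≡⟨ %-distribˡ-+ a x d ⟩
    (a % d + x % d) % d     ≡⟨ cong₂ (λ u v → (u + v) % d) a≡b x≡y ⟩
    (b % d + y % d) % d     ≡⟨ %-distribˡ-+ b y d ⟨
    (b + y) % d             ∎)
    where open ≡-Reasoning

  *-cong : ∀ {a b x y} → a ≈ b → x ≈ y → a * x ≈ b * y
  *-cong {a} {b} {x} {y} (mod-≡ a≡b) (mod-≡ x≡y) = mod-≡ (begin
    (a * x) % d             ≡⟨ %-distribˡ-* a x d ⟩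
    (a % d * (x % d)) % d   ≡⟨ cong₂ (λ u v → (u * v) % d) a≡b x≡y ⟩
    (b % d * (y % d)) % d   ≡⟨ %-distribˡ-* b y d ⟨
    (b * y) % d             ∎)
    where open ≡-Reasoning

  0%d≡0 : 0 % d ≡ 0
  0%d≡0 = n∣m⇒m%n≡0 0 d (d ∣0)

  ∣⇒≈0 : ∀ {x} → d ∣ x → x ≈ 0
  ∣⇒≈0 {x} d∣x = mod-≡ (trans (n∣m⇒m%n≡0 x d d∣x) (sym 0%d≡0))

  ≈0⇒∣ : ∀ {x} → x ≈ 0 → d ∣ x
  ≈0⇒∣ {x} (mod-≡ x≡0) = m%n≡0⇒n∣m x d (trans x≡0 0%d≡0)

  -_ : ℕ → ℕ
  - a = d ∸ a % d

  -‿inverseˡ : ∀ a → - a + a ≈ 0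
  -‿inverseˡ a = ∣⇒≈0 (divides (suc (a / d)) (begin
    - a + a                          ≡⟨ cong (- a +_) (m≡m%n+[m/n]*n a d) ⟩
    - a + (a % d + (a / d) * d)      ≡⟨ +-assoc (- a) (a % d) _ ⟨
    (- a + a % d) + (a / d) * d      ≡⟨ cong (_+ (a / d) * d) (m∸n+n≡m (m%n≤n a d)) ⟩
    d + (a / d) * d                  ∎))
    where open ≡-Reasoning

  +-cancelˡ : ∀ a {x y} → a + x ≈ a + y → x ≈ y
  +-cancelˡ a {x} {y} a+x≈a+y = begin
    x                 ≈⟨ +-cong (-‿inverseˡ a) (≈-refl {x}) ⟨
    (- a + a) + x     ≡⟨ +-assoc (- a) a x ⟩
    - a + (a + x)     ≈⟨ +-cong (≈-refl { - a}) a+x≈a+y ⟩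
    - a + (a + y)     ≡⟨ +-assoc (- a) a y ⟨
    (- a + a) + y     ≈⟨ +-cong (-‿inverseˡ a) (≈-refl {y}) ⟩
    y                 ∎
    where open ≈-Reasoning

  ≈1⇒^≈1 : ∀ {x} k → x ≈ 1 → x ^ k ≈ 1
  ≈1⇒^≈1 zero    x≈1 = ≈-refl
  ≈1⇒^≈1 (suc k) x≈1 = *-cong x≈1 (≈1⇒^≈1 k x≈1)

  odd-power-of-involution : ∀ {x} j → x * x ≈ 1 → x ^ (1 + 2 * j) ≈ x
  odd-power-of-involution {x} j x*x≈1 = begin
    x * x ^ (2 * j)     ≡⟨ cong (x *_) (^-*-assoc x 2 j) ⟨
    x * (x ^ 2) ^ j     ≈⟨ *-cong (≈-refl {x}) (≈1⇒^≈1 j x^2≈1) ⟩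
    x * 1               ≡⟨ *-identityʳ x ⟩
    x                   ∎
    where
      open ≈-Reasoning
      x^2≈1 : x ^ 2 ≈ 1
      x^2≈1 = ≈-trans (≈-reflexive (cong (x *_) (*-identityʳ x))) x*x≈1

  x+1≈0⇒x*x≈1 : ∀ {x} → x + 1 ≈ 0 → x * x ≈ 1
  x+1≈0⇒x*x≈1 {x} x+1≈0 = begin
    x * x               ≡⟨ +-identityʳ (x * x) ⟨
    x * x + 0           ≈⟨ +-cong (≈-refl {x * x}) x+1≈0 ⟨
    x * x + (x + 1)     ≡⟨ regroup x ⟩
    x * (x + 1) + 1     ≈⟨ +-cong (*-cong (≈-refl {x}) x+1≈0) (≈-refl {1}) ⟩
    x * 0 + 1           ≡⟨ cong (_+ 1) (*-zeroʳ x) ⟩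
    1                   ∎
    where
      open ≈-Reasoning
      regroup : ∀ x → x * x + (x + 1) ≡ x * (x + 1) + 1
      regroup = solve-∀

  1≈-1⇒∣2 : ∀ {x} → x ≈ 1 → x + 1 ≈ 0 → d ∣ 2
  1≈-1⇒∣2 x≈1 x+1≈0 = ≈0⇒∣ (≈-trans (+-cong (≈-sym x≈1) (≈-refl {1})) x+1≈0)

  cassini-even-≈ : ∀ k → d ∣ F (2 * k) → F (1 + 2 * k) * F (1 + 2 * k) ≈ 1
  cassini-even-≈ k d∣F = begin
    F (1 + 2 * k) * F (1 + 2 * k)     ≡⟨ cassini-even k ⟨
    F (2 * k) * F (2 + 2 * k) + 1
      ≈⟨ +-cong (*-cong (∣⇒≈0 d∣F) (≈-refl {F (2 + 2 * k)})) (≈-refl {1}) ⟩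
    1                                 ∎
    where open ≈-Reasoning

  cassini-odd-≈ : ∀ k → d ∣ F (1 + 2 * k) → F (2 + 2 * k) * F (2 + 2 * k) + 1 ≈ 0
  cassini-odd-≈ k d∣F = begin
    F (2 + 2 * k) * F (2 + 2 * k) + 1  ≡⟨ cassini-odd k ⟨
    F (1 + 2 * k) * F (3 + 2 * k)      ≈⟨ *-cong (∣⇒≈0 d∣F) (≈-refl {F (3 + 2 * k)}) ⟩
    0                                  ∎
    where open ≈-Reasoning

  module _ (α : ℕ) (d∣Fα : d ∣ F α) where

    F-shift : ∀ n → F (α + n) ≈ F (suc α) * F n
    F-shift zero = begin
      F (α + 0)              ≡⟨ cong F (+-identityʳ α) ⟩
      F α                    ≈⟨ ∣⇒≈0 d∣Fα ⟩
      0                      ≡⟨ *-zeroʳ (F (suc α)) ⟨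
      F (suc α) * 0          ∎
      where open ≈-Reasoning
    F-shift (suc n) = begin
      F (α + suc n)                          ≡⟨ cong F (+-suc α n) ⟩
      F (suc (α + n))                        ≡⟨ F-add α n ⟩
      F (suc α) * F (suc n) + F α * F n
        ≈⟨ +-cong (≈-refl {F (suc α) * F (suc n)}) (*-cong (∣⇒≈0 d∣Fα) (≈-refl {F n})) ⟩
      F (suc α) * F (suc n) + 0              ≡⟨ +-identityʳ _ ⟩
      F (suc α) * F (suc n)                  ∎
      where open ≈-Reasoning

    F-shift^ : ∀ k n → F (n + k * α) ≈ F (suc α) ^ k * F n
    F-shift^ zero n = ≈-reflexive (trans (cong F (+-identityʳ n)) (sym (*-identityˡ (F n))))
    F-shift^ (suc k) n = begin
      F (n + (α + k * α))                 ≡⟨ cong F (x+[y+z]≡y+[x+z] n α (k * α)) ⟩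
      F (α + (n + k * α))                 ≈⟨ F-shift (n + k * α) ⟩
      F (suc α) * F (n + k * α)           ≈⟨ *-cong (≈-refl {F (suc α)}) (F-shift^ k n) ⟩
      F (suc α) * (F (suc α) ^ k * F n)   ≡⟨ *-assoc (F (suc α)) _ (F n) ⟨
      F (suc α) ^ suc k * F n             ∎
      where open ≈-Reasoning

    multiplier-coprime : Coprime d (F (suc α))
    multiplier-coprime (i∣d , i∣Fsα) = F-coprime α (∣-trans i∣d d∣Fα , i∣Fsα)

    zero-shift : ∀ n → d ∣ F (α + n) → d ∣ F n
    zero-shift n d∣F =
      coprime-divisor multiplier-coprime (≈0⇒∣ (≈-trans (≈-sym (F-shift n)) (∣⇒≈0 d∣F)))

    zero-shift^ : ∀ k n → d ∣ F (n + k * α) → d ∣ F n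
    zero-shift^ zero    n d∣F = subst (λ m → d ∣ F m) (+-identityʳ n) d∣F
    zero-shift^ (suc k) n d∣F =
      zero-shift^ k n (zero-shift (n + k * α) (subst (λ m → d ∣ F m) (x+[y+z]≡y+[x+z] n α (k * α)) d∣F))

    multiplier-power≈1 : ∀ k → F (1 + k * α) ≈ 1 → F (suc α) ^ k ≈ 1
    multiplier-power≈1 k F≈1 =
      ≈-trans (≈-trans (≈-reflexive (sym (*-identityʳ _))) (≈-sym (F-shift^ k 1))) F≈1

  odd-zero∧unit⇒∣2 : ∀ k → d ∣ F (1 + 2 * k) → F (2 + 2 * k) ≈ 1 → d ∣ 2
  odd-zero∧unit⇒∣2 k d∣F c≈1 = 1≈-1⇒∣2 (*-cong c≈1 c≈1) (cassini-odd-≈ k d∣F)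

  even-zero∧odd-power≈1⇒unit : ∀ a j → d ∣ F (2 * a) →
                               F (1 + 2 * a) ^ (1 + 2 * j) ≈ 1 → F (1 + 2 * a) ≈ 1
  even-zero∧odd-power≈1⇒unit a j d∣F c^k≈1 =
    ≈-trans (≈-sym (odd-power-of-involution j (cassini-even-≈ a d∣F))) c^k≈1

  odd-zero∧twice-odd-power≈1⇒∣2 : ∀ a i → d ∣ F (1 + 2 * a) →
                                  F (2 + 2 * a) ^ (2 * (1 + 2 * i)) ≈ 1 → d ∣ 2
  odd-zero∧twice-odd-power≈1⇒∣2 a i d∣F c^k≈1 = 1≈-1⇒∣2 c*c≈1 (cassini-odd-≈ a d∣F)
    where
      open ≈-Reasoning
      c : ℕ
      c = F (2 + 2 * a)
      c*c≈1 : c * c ≈ 1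
      c*c≈1 = begin
        c * c                    ≈⟨ odd-power-of-involution i (x+1≈0⇒x*x≈1 (cassini-odd-≈ a d∣F)) ⟨
        (c * c) ^ (1 + 2 * i)    ≡⟨ cong (λ c² → c² ^ (1 + 2 * i)) (cong (c *_) (*-identityʳ c)) ⟨
        (c ^ 2) ^ (1 + 2 * i)    ≡⟨ ^-*-assoc c 2 (1 + 2 * i) ⟩
        c ^ (2 * (1 + 2 * i))    ≈⟨ c^k≈1 ⟩
        1                        ∎

  doubly-even-period⇒half-zero : ∀ k → d ∣ F (2 * (2 * k)) → F (1 + 2 * (2 * k)) ≈ 1 → d ∣ F (2 * k)
  doubly-even-period⇒half-zero k d∣F F≈1 = coprime-factors (L-coprime N) (d∣LN*FN , d∣L[1+N]*FN)
    where
      N : ℕ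
      N = 2 * k
      d∣LN*FN : d ∣ L N * F N
      d∣LN*FN = subst (d ∣_) (F-double N) d∣F
      d∣L[1+N]*FN : d ∣ L (1 + N) * F N
      d∣L[1+N]*FN = ≈0⇒∣ (+-cancelˡ 1 (≈-trans (≈-reflexive (sym (F-double-suc-even k))) F≈1))

least-witness : ∀ {P : Pred ℕ 0ℓ} → Decidable P → ∀ {n} → P n →
                ∃[ k ] P k × (∀ {j} → j < k → ¬ P j)
least-witness {P} P? {n} = <-rec (λ n → P n → Least) search n
  where
    Least : Set
    Least = ∃[ k ] P k × (∀ {j} → j < k → ¬ P j)
    search : ∀ n → (∀ {m} → m < n → P m → Least) → P n → Least
    search n below Pn with anyUpTo? P? n
    ... | yes (m , m<n , Pm) = below m<n Pm
    ... | no none            = n , Pn , λ j<n Pj → none (_ , j<n , Pj)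

record IsEntryPoint (d α : ℕ) : Set where
  field
    positive  : 0 < α
    divides-F : d ∣ F α
    minimal   : ∀ {n} → 0 < n → n < α → ¬ d ∣ F n

entryPoint-exists : ∀ {d n} → 0 < n → d ∣ F n → ∃[ α ] IsEntryPoint d α
entryPoint-exists {d} {suc n} _ d∣F with least-witness (λ i → d ∣? F (suc i)) {n} d∣F
... | i , d∣Fi , below = suc i , record
  { positive  = z<s
  ; divides-F = d∣Fi
  ; minimal   = λ { {suc j} _ (s<s j<i) → below j<i }
  }

entryPoint-∣ : ∀ {d α n} .{{_ : NonZero d}} → IsEntryPoint d α → d ∣ F n → α ∣ n
entryPoint-∣ {d} {α} {n} E d∣Fn = m%n≡0⇒n∣m n α remainder≡0
  where
    open IsEntryPoint E
    instance
      α≢0 : NonZero α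
      α≢0 = >-nonZero positive
    d∣F[n%α] : d ∣ F (n % α)
    d∣F[n%α] = Modulo.zero-shift^ d α divides-F (n / α) (n % α)
                 (subst (λ m → d ∣ F m) (m≡m%n+[m/n]*n n α) d∣Fn)
    remainder≡0 : n % α ≡ 0
    remainder≡0 with n % α | d∣F[n%α] | m%n<n n α
    ... | zero  | _   | _   = refl
    ... | suc r | d∣F | r<α = contradiction d∣F (minimal z<s r<α)

multiplier^quotient≡1 : ∀ {d α p} .{{_ : NonZero d}} → IsEntryPoint d α →
                        d ∣ F p → F (suc p) ≡ 1 [mod d ] →
                        ∃[ k ] (p ≡ k * α) × F (suc α) ^ k ≡ 1 [mod d ]
multiplier^quotient≡1 {d} {α} E d∣Fp F≡1 with divides k p≡kα ← entryPoint-∣ E d∣Fp =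
  k , p≡kα , Modulo.multiplier-power≈1 d α (IsEntryPoint.divides-F E) k
                (subst (λ n → F (suc n) ≡ 1 [mod d ]) p≡kα F≡1)

module ZeroCount (m : ℕ) where

  zeroCount-suc : ∀ a → zeroCount m (suc a) ≡ suc (length (filter (λ n → m ∣? F n) (applyUpTo suc a)))
  zeroCount-suc a = cong length (filter-accept (λ n → m ∣? F n) (m ∣0))

  zeroCount≡1⇒no-zero : ∀ {a} → zeroCount m (suc a) ≡ 1 → ∀ {n} → 0 < n → n < suc a → ¬ m ∣ F n
  zeroCount≡1⇒no-zero {a} count≡1 {suc i} _ (s<s i<a) m∣F =
    <⇒≢ (filter-some (λ n → m ∣? F n) (Any.applyUpTo⁺ suc m∣F i<a))
        (sym (suc-injective (trans (sym (zeroCount-suc a)) count≡1)))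

  no-zero⇒zeroCount≡1 : ∀ {a} → (∀ {n} → 0 < n → n < suc a → ¬ m ∣ F n) → zeroCount m (suc a) ≡ 1
  no-zero⇒zeroCount≡1 {a} no-zero = trans (zeroCount-suc a)
    (cong (suc ∘ length) (filter-none (λ n → m ∣? F n)
      (All.applyUpTo⁺₁ suc a (λ i<a → no-zero z<s (s<s i<a)))))

open ZeroCount

omega≡1⇒multiplier≡1 : ∀ {m} .{{_ : NonZero m}} → OmegaIs m 1 →
                        ∃[ α ] IsEntryPoint m α × F (suc α) ≡ 1 [mod m ]
omega≡1⇒multiplier≡1 {suc zero} _ = 1 , record
  { positive = z<s ; divides-F = divides 1 refl ; minimal = λ { z<s (s≤s ()) } } , mod-≡ refl
omega≡1⇒multiplier≡1 {m@(suc (suc _))} (suc a , (_ , period , _) , count≡1) = suc a , record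
  { positive  = z<s
  ; divides-F = Modulo.≈0⇒∣ m (mod-≡ (period 0))
  ; minimal   = zeroCount≡1⇒no-zero m count≡1
  } , mod-≡ (period 1)

multiplier≡1⇒omega≡1 : ∀ {d α} .{{_ : NonZero d}} → IsEntryPoint d α →
                       F (suc α) ≡ 1 [mod d ] → OmegaIs d 1
multiplier≡1⇒omega≡1 {suc zero} _ _ = refl
multiplier≡1⇒omega≡1 {d@(suc (suc _))} {α@(suc _)} E c≈1 =
  α , (z<s , period , least) , no-zero⇒zeroCount≡1 d minimal
  where
    open IsEntryPoint E
    open Modulo d
    period : IsPeriod d α
    period n = _≡_[mod_].%-≡ (begin
      F (n + α)            ≡⟨ cong F (+-comm n α) ⟩
      F (α + n)            ≈⟨ F-shift α divides-F n ⟩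
      F (suc α) * F n      ≈⟨ *-cong c≈1 (≈-refl {F n}) ⟩
      1 * F n              ≡⟨ *-identityˡ (F n) ⟩
      F n                  ∎)
      where open ≈-Reasoning
    least : ∀ q → 0 < q → IsPeriod d q → α ≤ q
    least q 0<q period-q = ≮⇒≥ (λ q<α → minimal 0<q q<α (≈0⇒∣ (mod-≡ (period-q 0))))

multiplier≡1⇒entryPoint≡2-mod-4 : ∀ {m p} .{{_ : NonZero m}} → 3 ≤ m → IsEntryPoint m p →
                                  F (suc p) ≡ 1 [mod m ] → ∃[ q ] p ≡ 2 * q × Odd q
multiplier≡1⇒entryPoint≡2-mod-4 {m} {p} 3≤m E c≈1 with evenOrOdd p
... | odd k = contradiction (Modulo.odd-zero∧unit⇒∣2 m k (IsEntryPoint.divides-F E) c≈1) (m≥3⇒m∤2 3≤m)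
... | even N with evenOrOdd N
...   | odd t        = N , refl , t , refl
...   | even zero    = contradiction (IsEntryPoint.positive E) (<-irrefl refl)
...   | even (suc k) =
  contradiction (Modulo.doubly-even-period⇒half-zero m (suc k) (IsEntryPoint.divides-F E) c≈1)
                (IsEntryPoint.minimal E z<s (m<m+n (2 * suc k) z<s))

twice-odd-period⇒multiplier≡1 : ∀ {d α p q} .{{_ : NonZero d}} → 3 ≤ d → IsEntryPoint d α →
                                d ∣ F p → F (suc p) ≡ 1 [mod d ] → p ≡ 2 * q → Odd q →
                                F (suc α) ≡ 1 [mod d ]
twice-odd-period⇒multiplier≡1 {d} {α} 3≤d E d∣Fp F≡1 p≡2q odd-q
  with k , p≡kα , c^k≡1 ← multiplier^quotient≡1 E d∣Fp F≡1
  with factors-of-twice-odd k α (trans (sym p≡kα) p≡2q) odd-q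
... | inj₁ (a , refl , j , refl) =
  Modulo.even-zero∧odd-power≈1⇒unit d a j (IsEntryPoint.divides-F E) c^k≡1
... | inj₂ ((a , refl) , j , refl , i , refl) =
  contradiction (Modulo.odd-zero∧twice-odd-power≈1⇒∣2 d a i (IsEntryPoint.divides-F E) c^k≡1)
                (m≥3⇒m∤2 3≤d)

divisor-multiplier≡1 : ∀ {m p d α} .{{_ : NonZero m}} .{{_ : NonZero d}} →
                       3 ≤ m → IsEntryPoint m p → F (suc p) ≡ 1 [mod m ] →
                       3 ≤ d → d ∣ m → IsEntryPoint d α → F (suc α) ≡ 1 [mod d ]
divisor-multiplier≡1 3≤m E c≈1 3≤d d∣m E′
  with q , p≡2q , odd-q ← multiplier≡1⇒entryPoint≡2-mod-4 3≤m E c≈1 =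
  twice-odd-period⇒multiplier≡1 3≤d E′ (∣-trans d∣m (IsEntryPoint.divides-F E))
                                (≡-mod-divisor d∣m c≈1) p≡2q odd-q

divisor-omega≡1 : ∀ {m p d} .{{_ : NonZero m}} → 3 ≤ m → IsEntryPoint m p → F (suc p) ≡ 1 [mod m ] →
                  3 ≤ d → d ∣ m → OmegaIs d 1
divisor-omega≡1 3≤m E c≈1 3≤d@(s≤s (s≤s (s≤s _))) d∣m
  with α , E′ ← entryPoint-exists (IsEntryPoint.positive E) (∣-trans d∣m (IsEntryPoint.divides-F E)) =
  multiplier≡1⇒omega≡1 E′ (divisor-multiplier≡1 3≤m E c≈1 3≤d d∣m E′)

entryPoint-8 : IsEntryPoint 8 6
entryPoint-8 = record
  { positive  = z<s
  ; divides-F = divides 1 refl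
  ; minimal   = λ { {suc i} _ (s<s i<5) → no-earlier-zero i<5 }
  }
  where
    no-earlier-zero : ∀ {i} → i < 5 → ¬ 8 ∣ F (suc i)
    no-earlier-zero = from-yes (allUpTo? (λ i → ¬? (8 ∣? F (suc i))) 5)

-- F 7 = 13 ≢ 1 (mod 8).
8∤m : ∀ {m p} .{{_ : NonZero m}} → 3 ≤ m → IsEntryPoint m p → F (suc p) ≡ 1 [mod m ] → ¬ 8 ∣ m
8∤m 3≤m E c≈1 8∣m with divisor-multiplier≡1 3≤m E c≈1 (s≤s (s≤s (s≤s z≤n))) 8∣m entryPoint-8
... | mod-≡ ()

shape⇒∣ : ∀ {m n} → m ≡ n ⊎ m ≡ 2 * n ⊎ m ≡ 4 * n → n ∣ m
shape⇒∣ (inj₁ refl)        = ∣-refl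
shape⇒∣ (inj₂ (inj₁ refl)) = n∣m*n 2
shape⇒∣ (inj₂ (inj₂ refl)) = n∣m*n 4

odd-divisors-omega≡1 : ∀ {m n} → (∀ {d} → 3 ≤ d → d ∣ m → OmegaIs d 1) → Odd n → n ∣ m →
                       ∀ d → 0 < d → d ∣ n → OmegaIs d 1
odd-divisors-omega≡1 _         _     _   1 _ _   = refl
odd-divisors-omega≡1 _         odd-n _   2 _ 2∣n = contradiction 2∣n (odd⇒2∤ odd-n)
odd-divisors-omega≡1 divisor-ω _     n∣m (suc (suc (suc _))) _ d∣n =
  divisor-ω (s≤s (s≤s (s≤s z≤n))) (∣-trans d∣n n∣m)

theorem2p11 : (m : ℕ) → 2 ≤ m → OmegaIs m 1 →
    ∃ λ n → (0 < n) × (∃ λ k → n ≡ 1 + 2 * k) ×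
      (m ≡ n ⊎ m ≡ 2 * n ⊎ m ≡ 4 * n) ×
      (∀ d → 0 < d → d ∣ n → OmegaIs d 1)
theorem2p11 1 (s≤s ()) _
theorem2p11 2 _ _ =
  1 , z<s , (0 , refl) , inj₂ (inj₁ refl)
  , λ d _ d∣1 → subst (λ d → OmegaIs d 1) (sym (∣1⇒≡1 d∣1)) refl
theorem2p11 m@(suc (suc (suc j))) _ ω
  with p , E , c≈1 ← omega≡1⇒multiplier≡1 ω
  with n , odd-n@(k , refl) , shape ← two-adic-split m (8∤m (m≤m+n 3 j) E c≈1)
  = n , z<s , odd-n , shape
  , odd-divisors-omega≡1 (divisor-omega≡1 (m≤m+n 3 j) E c≈1) odd-n (shape⇒∣ shape)
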